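{- Let $n$ be a non-negative integer and let $m=\lfloor\frac n3\rfloor+\delta_{1,(n\bmod 3)}$. For each $i\in\{1,\dots,\lfloor\frac n3\rfloor\}$ choose an integer $j_i\in\{2i,\dots,n-i\}$. When $n\equiv1\pmod 3$, also set $j_{(n+2)/3}=\frac{2n+1}{3}$. Then $G_R=\{(i,j_i): i\in\{1,\dots,m\}\}$ is a generating index set of $\mathcal{RST}(n)$.
   Context: A binary Steinhaus triangle of size $n\ge0$ is an array $(a_{i,j})_{1\le i\le j\le n}$ of elements of $\{0,1\}$ with $a_{i,j}\equiv a_{i-1,j-1}+a_{i-1,j}\pmod 2$ for all $2\le i\le j\le n$. These triangles form a vector space $\mathcal{ST}(n)$ over $\mathbb{Z}/2\mathbb{Z}$ under entrywise addition. The rotation $r:\mathcal{ST}(n)\to\mathcal{ST}(n)$ is $r((a_{i,j}))=(a_{j-i+1,n-i+1})_{1\le i\le j\le n}$, and $\mathcal{RST}(n)=\{\nabla\in\mathcal{ST}(n): r(\nabla)=\nabla\}$. For a linear subspace $V\subseteq\mathcal{ST}(n)$, a subset $G\subseteq\{(i,j):1\le i\le j\le n\}$ is a generating index set of $V$ if the linear map $V\to\{0,1\}^G$, $(a_{i,j})\mapsto(a_{i,j})_{(i,j)\in G}$, is an isomorphism. The symbol $\delta_{a,(n\bmod b)}$ equals $1$ if $n\equiv a\pmod b$ and $0$ otherwise. -}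

module Defs where

open import Data.Nat using (ℕ; zero; suc; _+_; _*_; _∸_; _≤_; _/_; _%_)
open import Data.Bool using (Bool; true; false; _xor_; if_then_else_)
open import Data.Nat using (_≡ᵇ_)
open import Data.Product using (_×_)
open import Relation.Binary.PropositionalEquality using (_≡_)

-- A binary array indexed by pairs of naturals; only the entries at
-- indices (i,j) with 1 ≤ i ≤ j ≤ n are meaningful for a triangle of size n.
Array : Set
Array = ℕ → ℕ → Bool

InIdx : ℕ → ℕ → ℕ → Set
InIdx n i j = (1 ≤ i) × (i ≤ j) × (j ≤ n)

SameTri : ℕ → Array → Array → Set
SameTri n a b = ∀ i j → InIdx n i j → a i j ≡ b i j

IsST : ℕ → Array → Set
IsST n a = ∀ i j → 2 ≤ i → i ≤ j → j ≤ n →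
           a i j ≡ (a (i ∸ 1) (j ∸ 1) xor a (i ∸ 1) j)

rot : ℕ → Array → Array
rot n a i j = a (j ∸ i + 1) (n + 1 ∸ i)

IsRST : ℕ → Array → Set
IsRST n a = IsST n a × SameTri n (rot n a) a

δ1mod3 : ℕ → ℕ
δ1mod3 n = if (n % 3) ≡ᵇ 1 then 1 else 0

mR : ℕ → ℕ
mR n = n / 3 + δ1mod3 n

-- G = {(i, j i) : 1 ≤ i ≤ m} is a generating index set of RST(n):
-- the restriction map RST(n) → {0,1}^G is bijective (it is automatically linear).
GeneratingRST : ℕ → ℕ → (ℕ → ℕ) → Set
GeneratingRST n m j =
  ((b : ℕ → Bool) → Data.Product.Σ Array (λ a → IsRST n a ×
       (∀ i → 1 ≤ i → i ≤ m → a i (j i) ≡ b i)))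
  × ((a a' : Array) → IsRST n a → IsRST n a' →
       (∀ i → 1 ≤ i → i ≤ m → a i (j i) ≡ a' i (j i)) → SameTri n a a')

module Submission where

-- The proof peels off the outer layer.  The entries a (i+1) (j+2) of a
-- triangle of size N + 3 form its inner triangle, of size N.  Rotation
-- commutes with taking inner triangles, so the inner triangle of an RST
-- triangle is RST, and the columns j (i+1) - 2 are admissible for N.  The
-- outer layer then carries exactly one bit, read at (1, j 1):
--  * every RST triangle of size N is the inner triangle of one of size N + 3
--    (extend it to a Steinhaus triangle by a suitable top row, then
--    symmetrise a ↦ a + r a + r² a, which keeps the inner part), and the
--    symmetrised first-row indicator has zero inner part and a 1 at (1, j 1),
--    so this bit can be set freely: the restriction map is surjective;
--  * an RST triangle with zero inner part has a top row constant on
--    2, …, N + 2 whose corners follow by rotation, so it is zero once it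
--    vanishes at (1, j 1): the restriction map has trivial kernel, hence
--    (being linear) is injective.

open import Defs
open import Data.Nat using (ℕ; _+_; _*_; _∸_; _≤_; _/_; _%_)
open import Data.Product using (_×_)
open import Relation.Binary.PropositionalEquality using (_≡_)

open import Algebra.Bundles using (CommutativeRing)
open import Data.Bool using (Bool; true; false; _xor_; _∧_; if_then_else_)
open import Data.Bool.Properties
  using (xor-assoc; xor-comm; xor-same; xor-identityʳ; ∧-identityʳ; ∧-zeroʳ;
         ∧-distribˡ-xor; xor-∧-commutativeRing)
open import Data.Nat using (zero; suc; z≤n; s≤s; _≡ᵇ_)
open import Data.Nat.Properties
  using (m≤n⇒∃[o]m+o≡n; m+n∸m≡n; +-comm; +-suc; m≤m+n; m≤n+m; ≤-refl; ≤-trans;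
         n≤1+n; ≤-pred; m≤n⇒m<n∨m≡n; ∸-monoˡ-≤; ∸-+-assoc)
open import Data.Nat.DivMod using (m/n≡1+[m∸n]/n; [m+n]%n≡m%n)
open import Data.Nat.Tactic.RingSolver using (solve-∀)
open import Data.Product using (Σ; _,_; proj₁; proj₂)
open import Data.Sum using (inj₁; inj₂)
open import Function using (_∘_)
open import Relation.Binary.PropositionalEquality
  using (refl; sym; trans; cong; cong₂; subst; module ≡-Reasoning)
open import Algebra.Properties.CommutativeSemigroup
  (CommutativeRing.+-commutativeSemigroup xor-∧-commutativeRing)
  using (interchange; x∙yz≈z∙xy)

xor-cancelˡ : ∀ p q → p xor (p xor q) ≡ q
xor-cancelˡ p q = trans (sym (xor-assoc p p q)) (cong (_xor q) (xor-same p))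

xor-thrice : ∀ p → p xor (p xor p) ≡ p
xor-thrice p = trans (cong (p xor_) (xor-same p)) (xor-identityʳ p)

xor-solve : ∀ a b c → c ≡ a xor b → a ≡ b xor c
xor-solve a b c h = sym (trans (cong (b xor_) (trans h (xor-comm a b))) (xor-cancelˡ b a))

xor≡false⇒≡ : ∀ p q → p xor q ≡ false → p ≡ q
xor≡false⇒≡ p q h = sym (trans (sym (xor-cancelˡ p q)) (trans (cong (p xor_) h) (xor-identityʳ p)))

O : Array
O _ _ = false

infixl 6 _⊕_
_⊕_ : Array → Array → Array
(a ⊕ b) i j = a i j xor b i j

infixr 7 _·_
_·_ : Bool → Array → Array
(c · a) i j = c ∧ a i j

difference-zero : ∀ n a b → SameTri n (a ⊕ b) O → SameTri n a b
difference-zero n a b h i j ix = xor≡false⇒≡ (a i j) (b i j) (h i j ix)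

-- Every index of a triangle of size n has the form (1+p, 1+p+d) with
-- n = 1+p+d+e; these coordinates make the rotation transparent.
data Coordinates : ℕ → ℕ → ℕ → Set where
  coords : ∀ p d e → Coordinates (suc p + d + e) (suc p) (suc p + d)

coordinates : ∀ {n i j} → InIdx n i j → Coordinates n i j
coordinates {i = suc p} (s≤s z≤n , i≤j , j≤n) with m≤n⇒∃[o]m+o≡n i≤j
... | d , refl with m≤n⇒∃[o]m+o≡n j≤n
... | e , refl = coords p d e

rot-coords : ∀ {n} p d e (a : Array) → n ≡ suc p + d + e →
             rot n a (suc p) (suc p + d) ≡ a (suc d) (suc d + e)
rot-coords p d e a refl = cong₂ a row column
  where
  row : p + d ∸ p + 1 ≡ suc d
  row = trans (cong (_+ 1) (m+n∸m≡n p d)) (+-comm d 1)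
  shift : ∀ p d e → p + d + e + 1 ≡ p + suc (d + e)
  shift = solve-∀
  column : p + d + e + 1 ∸ p ≡ suc d + e
  column = trans (cong (_∸ p) (shift p d e)) (m+n∸m≡n p (suc (d + e)))

rotated-index : ∀ p d e → InIdx (suc p + d + e) (suc d) (suc d + e)
rotated-index p d e =
  s≤s z≤n , m≤m+n (suc d) e , subst (suc d + e ≤_) (total p d e) (m≤n+m (suc d + e) p)
  where
  total : ∀ p d e → p + (suc d + e) ≡ suc p + d + e
  total = solve-∀

rot-respects : ∀ n a b → SameTri n a b → SameTri n (rot n a) (rot n b)
rot-respects n a b h i j ix with coordinates ix
... | coords p d e =
  trans (rot-coords p d e a refl)
        (trans (h _ _ (rotated-index p d e)) (sym (rot-coords p d e b refl)))

rot³ : ∀ n a → SameTri n (rot n (rot n (rot n a))) a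
rot³ n a i j ix with coordinates ix
... | coords p d e =
  trans (rot-coords p d e (rot n (rot n a)) refl)
  (trans (rot-coords d e p (rot n a) (cycle p d e))
         (rot-coords e p d a (trans (cycle p d e) (cycle d e p))))
  where
  cycle : ∀ p d e → suc p + d + e ≡ suc d + e + p
  cycle = solve-∀

⊕-ST : ∀ n a b → IsST n a → IsST n b → IsST n (a ⊕ b)
⊕-ST n a b sa sb i j p q r =
  trans (cong₂ _xor_ (sa i j p q r) (sb i j p q r))
        (interchange (a (i ∸ 1) (j ∸ 1)) (a (i ∸ 1) j) (b (i ∸ 1) (j ∸ 1)) (b (i ∸ 1) j))

·-ST : ∀ n c a → IsST n a → IsST n (c · a)
·-ST n c a sa i j p q r = trans (cong (c ∧_) (sa i j p q r)) (∧-distribˡ-xor c _ _)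

-- The rule of the rotated triangle at (2+q, 2+q+d) is the rule of the
-- original one at (2+d, 2+d+e), solved for its upper-left entry.
rot-ST : ∀ n a → IsST n a → IsST n (rot n a)
rot-ST n a st i j 2≤i i≤j j≤n with coordinates (≤-trans (s≤s z≤n) 2≤i , i≤j , j≤n)
rot-ST n a st .1 _ (s≤s ()) _ _ | coords zero d e
... | coords (suc q) d e =
  trans (rot-coords (suc q) d e a refl)
  (trans (xor-solve A B C rule) (sym (cong₂ _xor_ left right)))
  where
  A B C : Bool
  A = a (suc d) (suc d + e)
  B = a (suc d) (suc d + suc e)
  C = a (suc (suc d)) (suc (suc d) + e)
  left : rot n a (suc q) (suc q + d) ≡ B
  left = rot-coords q d (suc e) a (sym (+-suc (suc q + d) e))
  right : rot n a (suc q) (suc (suc q) + d) ≡ C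
  right = trans (cong (rot n a (suc q)) (sym (+-suc (suc q) d)))
                (rot-coords q (suc d) e a (cong (_+ e) (sym (+-suc (suc q) d))))
  bound : suc (d + suc e) ≤ n
  bound = subst (suc d + suc e ≤_) (total q d e) (m≤n+m (suc d + suc e) q)
    where
    total : ∀ q d e → q + (suc d + suc e) ≡ suc (suc q) + d + e
    total = solve-∀
  rule : C ≡ A xor B
  rule = trans (cong (a (suc (suc d))) (cong suc (sym (+-suc d e))))
         (trans (st (suc (suc d)) (suc d + suc e) (s≤s (s≤s z≤n))
                    (s≤s (subst (suc d ≤_) (sym (+-suc d e)) (s≤s (m≤m+n d e)))) bound)
                (cong (_xor B) (cong (a (suc d)) (+-suc d e))))

ST-top-row : ∀ n a b → IsST n a → IsST n b →
             (∀ k → 1 ≤ k → k ≤ n → a 1 k ≡ b 1 k) → SameTri n a b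
ST-top-row n a b sa sb top (suc zero) j (_ , 1≤j , j≤n) = top j 1≤j j≤n
ST-top-row n a b sa sb top (suc (suc i)) (suc j) (_ , s≤s i<j , j<n) =
  trans (sa (suc (suc i)) (suc j) (s≤s (s≤s z≤n)) (s≤s i<j) j<n)
  (trans (cong₂ _xor_
           (ST-top-row n a b sa sb top (suc i) j (s≤s z≤n , i<j , ≤-trans (n≤1+n j) j<n))
           (ST-top-row n a b sa sb top (suc i) (suc j) (s≤s z≤n , ≤-trans i<j (n≤1+n j) , j<n)))
   (sym (sb (suc (suc i)) (suc j) (s≤s (s≤s z≤n)) (s≤s i<j) j<n)))

ST-zero-top-row : ∀ n a → IsST n a → (∀ k → 1 ≤ k → k ≤ n → a 1 k ≡ false) → SameTri n a O
ST-zero-top-row n a sa = ST-top-row n a O sa (λ _ _ _ _ _ → refl)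

fromTopRow : (ℕ → Bool) → Array
fromTopRow x zero j = false
fromTopRow x (suc zero) j = x j
fromTopRow x (suc (suc i)) j = fromTopRow x (suc i) (j ∸ 1) xor fromTopRow x (suc i) j

fromTopRow-ST : ∀ n x → IsST n (fromTopRow x)
fromTopRow-ST n x (suc (suc i)) j _ _ _ = refl
fromTopRow-ST n x (suc zero) j (s≤s ()) _ _

O-RST : ∀ n → IsRST n O
O-RST n = (λ _ _ _ _ _ → refl) , λ _ _ _ → refl

⊕-RST : ∀ n a b → IsRST n a → IsRST n b → IsRST n (a ⊕ b)
⊕-RST n a b (sa , ra) (sb , rb) =
  ⊕-ST n a b sa sb , λ i j ix → cong₂ _xor_ (ra i j ix) (rb i j ix)

·-RST : ∀ n c a → IsRST n a → IsRST n (c · a)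
·-RST n c a (sa , ra) = ·-ST n c a sa , λ i j ix → cong (c ∧_) (ra i j ix)

symmetrise : ℕ → Array → Array
symmetrise n a = a ⊕ (rot n a ⊕ rot n (rot n a))

-- r (a + r a + r² a) = r a + r² a + a because r³ = 1.
symmetrise-RST : ∀ n a → IsST n a → IsRST n (symmetrise n a)
symmetrise-RST n a st =
  ⊕-ST n _ _ st (⊕-ST n _ _ (rot-ST n a st) (rot-ST n _ (rot-ST n a st))) ,
  λ i j ix → trans (cong (λ z → rot n a i j xor (rot n (rot n a) i j xor z)) (rot³ n a i j ix))
                   (x∙yz≈z∙xy (rot n a i j) (rot n (rot n a) i j) (a i j))

-- The inner triangle of a triangle of size N + 3 is the triangle of size N
-- obtained by deleting the outer layer (first row, first and last column).

inner : Array → Array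
inner a i j = a (suc i) (suc (suc j))

inner-index : ∀ N i j → InIdx N i j → InIdx (3 + N) (suc i) (suc (suc j))
inner-index N i j (_ , i≤j , j≤N) =
  s≤s z≤n , ≤-trans (s≤s i≤j) (s≤s (n≤1+n j)) , s≤s (s≤s (≤-trans j≤N (n≤1+n N)))

inner-ST : ∀ N a → IsST (3 + N) a → IsST N (inner a)
inner-ST N a st (suc (suc i)) (suc j) (s≤s (s≤s z≤n)) (s≤s i≤j) j≤N =
  st (suc (suc (suc i))) (suc (suc (suc j))) (s≤s (s≤s z≤n))
     (s≤s (s≤s (s≤s (≤-trans (n≤1+n i) i≤j))))
     (s≤s (s≤s (s≤s (≤-trans (n≤1+n j) j≤N))))

-- Rotation commutes with taking the inner triangle: in coordinates the
-- inner index (p, d, e) is the outer index (1+p, 1+d, 1+e).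
inner-rot : ∀ N a → SameTri N (inner (rot (3 + N) a)) (rot N (inner a))
inner-rot N a i j ix with coordinates ix
... | coords p d e =
  trans (cong (rot (3 + N) a (suc (suc p))) (cong (suc ∘ suc) (sym (+-suc p d))))
  (trans (rot-coords (suc p) (suc d) (suc e) a (layer p d e))
  (trans (cong (a (suc (suc d))) (cong (suc ∘ suc) (+-suc d e)))
         (sym (rot-coords p d e (inner a) refl))))
  where
  layer : ∀ p d e → 3 + (suc p + d + e) ≡ suc (suc p) + suc d + suc e
  layer = solve-∀

inner-RST : ∀ N a → IsRST (3 + N) a → IsRST N (inner a)
inner-RST N a (sa , ra) =
  inner-ST N a sa ,
  λ i j ix → trans (sym (inner-rot N a i j ix)) (ra (suc i) (suc (suc j)) (inner-index N i j ix))

inner-symmetrise : ∀ N E T → IsRST N T → SameTri N (inner E) T →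
                   SameTri N (inner (symmetrise (3 + N) E)) T
inner-symmetrise N E T rT h i j ix =
  trans (cong₂ _xor_ (h i j ix) (cong₂ _xor_ (h₁ i j ix) (h₂ i j ix))) (xor-thrice (T i j))
  where
  inner-rotated : ∀ F → SameTri N (inner F) T → SameTri N (inner (rot (3 + N) F)) T
  inner-rotated F hF i j ix =
    trans (inner-rot N F i j ix) (trans (rot-respects N (inner F) T hF i j ix) (proj₂ rT i j ix))
  h₁ : SameTri N (inner (rot (3 + N) E)) T
  h₁ = inner-rotated E h
  h₂ : SameTri N (inner (rot (3 + N) (rot (3 + N) E))) T
  h₂ = inner-rotated (rot (3 + N) E) h₁

-- Every Steinhaus triangle T of size N is the inner triangle of a Steinhaus
-- triangle of size N + 3: take the top row x with x 1 = x 2 = 0 and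
-- x (k+1) + x (k+2) = T 1 k.
topRowAbove : Array → ℕ → Bool
topRowAbove T zero = false
topRowAbove T (suc zero) = false
topRowAbove T (suc (suc zero)) = false
topRowAbove T (suc (suc (suc k))) = topRowAbove T (suc (suc k)) xor T 1 (suc k)

-- Its second row, hence the top row of its inner triangle, is T 1.
inner-topRowAbove : ∀ N T → IsST N T → SameTri N (inner (fromTopRow (topRowAbove T))) T
inner-topRowAbove N T sT =
  ST-top-row N _ T (inner-ST N (fromTopRow (topRowAbove T)) (fromTopRow-ST _ _)) sT top
  where
  top : ∀ k → 1 ≤ k → k ≤ N → inner (fromTopRow (topRowAbove T)) 1 k ≡ T 1 k
  top (suc k) _ _ = xor-cancelˡ (topRowAbove T (suc (suc k))) (T 1 (suc k))

RST-extends : ∀ N T → IsRST N T →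
              Σ Array (λ S → IsRST (3 + N) S × SameTri N (inner S) T)
RST-extends N T rT =
  symmetrise (3 + N) E ,
  symmetrise-RST (3 + N) E (fromTopRow-ST _ _) ,
  inner-symmetrise N E T rT (inner-topRowAbove N T (proj₁ rT))
  where
  E : Array
  E = fromTopRow (topRowAbove T)

firstRow : Array
firstRow i j = i ≡ᵇ 1

-- Rows below the first are 0 + 0, so firstRow is Steinhaus.
firstRow-ST : ∀ n → IsST n firstRow
firstRow-ST n (suc (suc i)) j _ _ _ = sym (xor-same (suc i ≡ᵇ 1))
firstRow-ST n (suc zero) j (s≤s ()) _ _

border : ℕ → Array
border n = symmetrise n firstRow

border-RST : ∀ n → IsRST n (border n)
border-RST n = symmetrise-RST n firstRow (firstRow-ST n)

inner-border : ∀ N → SameTri N (inner (border (3 + N))) O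
inner-border N = inner-symmetrise N firstRow O (O-RST N) (λ { (suc i) j _ → refl })

-- At (1, 2+d) the two rotations of firstRow read entries outside row 1.
border-top : ∀ N k → 2 ≤ k → k ≤ 2 + N → border (3 + N) 1 k ≡ true
border-top N (suc zero) (s≤s ()) _
border-top N (suc (suc d)) _ (s≤s (s≤s d≤N)) with m≤n⇒∃[o]m+o≡n d≤N
... | e , refl = cong (true xor_) (cong₂ _xor_ once twice)
  where
  n : ℕ
  n = 3 + (d + e)
  split₁ : ∀ d e → 3 + (d + e) ≡ 1 + suc d + suc e
  split₁ = solve-∀
  split₂ : ∀ d e → 3 + (d + e) ≡ suc (suc d) + suc e + zero
  split₂ = solve-∀
  once : rot n firstRow 1 (suc (suc d)) ≡ false
  once = rot-coords zero (suc d) (suc e) firstRow (split₁ d e)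
  twice : rot n (rot n firstRow) 1 (suc (suc d)) ≡ false
  twice = trans (rot-coords zero (suc d) (suc e) (rot n firstRow) (split₁ d e))
                (rot-coords (suc d) (suc e) zero firstRow (split₂ d e))

-- If the inner triangle of a Steinhaus triangle D of size N + 3 vanishes,
-- the rule at (2, k+1) makes the top row constant on 2, …, N + 2.
top-row-constant : ∀ N D → IsST (3 + N) D → SameTri N (inner D) O →
                   ∀ k → 2 ≤ k → k ≤ 2 + N → D 1 k ≡ D 1 2
top-row-constant N D sD iz (suc zero) (s≤s ()) _
top-row-constant N D sD iz (suc (suc zero)) _ _ = refl
top-row-constant N D sD iz (suc (suc (suc k))) _ le =
  trans (sym step) (top-row-constant N D sD iz (suc (suc k)) (s≤s (s≤s z≤n)) (≤-trans (n≤1+n _) le))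
  where
  step : D 1 (suc (suc k)) ≡ D 1 (suc (suc (suc k)))
  step = xor≡false⇒≡ _ _
    (trans (sym (sD 2 (suc (suc (suc k))) (s≤s (s≤s z≤n)) (s≤s (s≤s z≤n)) (≤-trans le (n≤1+n _))))
           (iz 1 (suc k) (s≤s z≤n , s≤s z≤n , ≤-pred (≤-pred le))))

-- An RST triangle of size N + 3 with vanishing inner triangle which vanishes
-- at one inner position (1, k) of the top row is zero: the top row is zero on
-- 2, …, N + 2, and rotation carries this zero to the two corners.
outer-layer-zero : ∀ N D → IsRST (3 + N) D → SameTri N (inner D) O →
                   ∀ k → 2 ≤ k → k ≤ 2 + N → D 1 k ≡ false → SameTri (3 + N) D O
outer-layer-zero N D (sD , rD) iz k 2≤k k≤ Dk = ST-zero-top-row (3 + N) D sD top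
  where
  constant : ∀ k → 2 ≤ k → k ≤ 2 + N → D 1 k ≡ D 1 2
  constant = top-row-constant N D sD iz
  D12 : D 1 2 ≡ false
  D12 = trans (sym (constant k 2≤k k≤)) Dk
  D1last : D 1 (2 + N) ≡ false
  D1last = trans (constant (2 + N) (s≤s (s≤s z≤n)) ≤-refl) D12
  D22 : D 2 2 ≡ false
  D22 = trans (sym (rD 2 2 (s≤s z≤n , s≤s (s≤s z≤n) , s≤s (s≤s z≤n))))
              (trans (cong (D 1 ∘ suc) (+-comm N 1)) D1last)
  D11 : D 1 1 ≡ false
  D11 = xor≡false⇒≡ (D 1 1) false
          (trans (cong (D 1 1 xor_) (sym D12))
          (trans (sym (sD 2 2 (s≤s (s≤s z≤n)) (s≤s (s≤s z≤n)) (s≤s (s≤s z≤n)))) D22))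
  D1corner : D 1 (3 + N) ≡ false
  D1corner = trans (cong (D 1 ∘ suc ∘ suc) (sym (+-comm N 1)))
                   (trans (rD 1 1 (s≤s z≤n , s≤s z≤n , s≤s z≤n)) D11)
  top : ∀ k → 1 ≤ k → k ≤ 3 + N → D 1 k ≡ false
  top (suc zero) _ _ = D11
  top (suc (suc k)) _ le with m≤n⇒m<n∨m≡n le
  ... | inj₁ lt = trans (constant (suc (suc k)) (s≤s (s≤s z≤n)) (≤-pred lt)) D12
  ... | inj₂ eq = trans (cong (D 1) eq) D1corner

Admissible : ℕ → (ℕ → ℕ) → Set
Admissible n j = (∀ i → 1 ≤ i → i ≤ n / 3 → (2 * i ≤ j i) × (j i ≤ n ∸ i))
               × (n % 3 ≡ 1 → j ((n + 2) / 3) ≡ (2 * n + 1) / 3)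

innerColumns : (ℕ → ℕ) → ℕ → ℕ
innerColumns j i = j (suc i) ∸ 2

div3-step : ∀ N → (3 + N) / 3 ≡ suc (N / 3)
div3-step N = m/n≡1+[m∸n]/n {3 + N} {3} (s≤s (s≤s (s≤s z≤n)))

mod3-step : ∀ N → (3 + N) % 3 ≡ N % 3
mod3-step N = trans (cong (_% 3) (+-comm 3 N)) ([m+n]%n≡m%n N 3)

mR-step : ∀ N → mR (3 + N) ≡ suc (mR N)
mR-step N = cong₂ _+_ (div3-step N) (cong (λ r → if r ≡ᵇ 1 then 1 else 0) (mod3-step N))

admissible-inner : ∀ N j → Admissible (3 + N) j → Admissible N (innerColumns j)
admissible-inner N j (bounds , last) = inner-bounds , inner-last
  where
  inner-bounds : ∀ i → 1 ≤ i → i ≤ N / 3 →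
                 (2 * i ≤ innerColumns j i) × (innerColumns j i ≤ N ∸ i)
  inner-bounds i _ i≤ with bounds (suc i) (s≤s z≤n) (subst (suc i ≤_) (sym (div3-step N)) (s≤s i≤))
  ... | lower , upper =
    ∸-monoˡ-≤ 2 (subst (_≤ j (suc i)) (double i) lower) ,
    subst (innerColumns j i ≤_) drop (∸-monoˡ-≤ 2 upper)
    where
    double : ∀ i → 2 * suc i ≡ 2 + 2 * i
    double = solve-∀
    drop : (2 + N ∸ i) ∸ 2 ≡ N ∸ i
    drop = trans (∸-+-assoc (2 + N) i 2) (cong (2 + N ∸_) (+-comm i 2))
  inner-last : N % 3 ≡ 1 → innerColumns j ((N + 2) / 3) ≡ (2 * N + 1) / 3
  inner-last N≡1 = cong (_∸ 2) (begin
      j (suc ((N + 2) / 3))            ≡⟨ cong j (sym (div3-step (N + 2))) ⟩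
      j ((3 + N + 2) / 3)              ≡⟨ last (trans (mod3-step N) N≡1) ⟩
      (2 * (3 + N) + 1) / 3            ≡⟨ cong (_/ 3) (twice-step N) ⟩
      (3 + (3 + (2 * N + 1))) / 3      ≡⟨ div3-step (3 + (2 * N + 1)) ⟩
      suc ((3 + (2 * N + 1)) / 3)      ≡⟨ cong suc (div3-step (2 * N + 1)) ⟩
      2 + (2 * N + 1) / 3              ∎)
    where
    open ≡-Reasoning
    twice-step : ∀ N → 2 * (3 + N) + 1 ≡ 3 + (3 + (2 * N + 1))
    twice-step = solve-∀

mR-pred : ∀ N i → suc i ≤ mR (3 + N) → i ≤ mR N
mR-pred N i le = ≤-pred (subst (suc i ≤_) (mR-step N) le)

mR-suc : ∀ N i → i ≤ mR N → suc i ≤ mR (3 + N)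
mR-suc N i le = subst (suc i ≤_) (sym (mR-step N)) (s≤s le)

admissible-first : ∀ N j → Admissible (3 + N) j → (2 ≤ j 1) × (j 1 ≤ 2 + N)
admissible-first N j (bounds , _) =
  bounds 1 (s≤s z≤n) (subst (1 ≤_) (sym (div3-step N)) (s≤s z≤n))

∸2-inverse : ∀ m → 1 ≤ m ∸ 2 → 2 + (m ∸ 2) ≡ m
∸2-inverse (suc (suc m)) _ = refl

admissible-index : ∀ n j → Admissible n j → ∀ i → 1 ≤ i → i ≤ mR n → InIdx n i (j i)
admissible-index zero j _ (suc i) _ ()
admissible-index 1 j (_ , last) (suc zero) _ _ =
  subst (InIdx 1 1) (sym (last refl)) (s≤s z≤n , s≤s z≤n , s≤s z≤n)
admissible-index 1 j _ (suc (suc i)) _ (s≤s ())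
admissible-index 2 j _ (suc i) _ ()
admissible-index (suc (suc (suc N))) j adm (suc zero) _ _ with admissible-first N j adm
... | 2≤j , j≤ = s≤s z≤n , ≤-trans (s≤s z≤n) 2≤j , ≤-trans j≤ (n≤1+n _)
admissible-index (suc (suc (suc N))) j adm (suc (suc i)) _ le
  with admissible-index N (innerColumns j) (admissible-inner N j adm) (suc i) (s≤s z≤n) (mR-pred N (suc i) le)
... | 1≤J , i≤J , J≤N =
  subst (InIdx (3 + N) (2 + i)) (∸2-inverse (j (2 + i)) (≤-trans 1≤J i≤J))
        (s≤s z≤n , ≤-trans (s≤s i≤J) (n≤1+n _) , s≤s (s≤s (≤-trans J≤N (n≤1+n N))))

inner-column : ∀ N j → Admissible (3 + N) j → (A : Array) →
               ∀ i → 1 ≤ i → i ≤ mR N → A (suc i) (j (suc i)) ≡ inner A i (innerColumns j i)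
inner-column N j adm A i 1≤i le =
  cong (A (suc i)) (sym (∸2-inverse (j (suc i)) (≤-trans 1≤i i≤J)))
  where
  i≤J : i ≤ innerColumns j i
  i≤J = proj₁ (proj₂ (admissible-index N (innerColumns j) (admissible-inner N j adm) i 1≤i le))

Realises : ℕ → (ℕ → ℕ) → (ℕ → Bool) → Array → Set
Realises n j b a = ∀ i → 1 ≤ i → i ≤ mR n → a i (j i) ≡ b i

-- Realisation step: an RST triangle T of size N realising the bits beyond
-- the first on the inner positions extends to an RST triangle of size N + 3,
-- and adding a multiple of the border triangle adjusts the first bit.
realise-outer : ∀ N j → Admissible (3 + N) j → (b : ℕ → Bool) →
                Σ Array (λ T → IsRST N T × Realises N (innerColumns j) (b ∘ suc) T) →
                Σ Array (λ A → IsRST (3 + N) A × Realises (3 + N) j b A)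
realise-outer N j adm b (T , rT , vT) =
  A , ⊕-RST n S (c · K) rS (·-RST n c K (border-RST n)) , values
  where
  open ≡-Reasoning
  n : ℕ
  n = 3 + N
  extension : Σ Array (λ S → IsRST n S × SameTri N (inner S) T)
  extension = RST-extends N T rT
  S K : Array
  S = proj₁ extension
  K = border n
  rS : IsRST n S
  rS = proj₁ (proj₂ extension)
  iS : SameTri N (inner S) T
  iS = proj₂ (proj₂ extension)
  c : Bool
  c = S 1 (j 1) xor b 1
  A : Array
  A = S ⊕ c · K
  values : Realises n j b A
  values (suc zero) _ _ = begin
    S 1 (j 1) xor (c ∧ K 1 (j 1)) ≡⟨ cong (λ z → S 1 (j 1) xor (c ∧ z)) corner ⟩
    S 1 (j 1) xor (c ∧ true)      ≡⟨ cong (S 1 (j 1) xor_) (∧-identityʳ c) ⟩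
    S 1 (j 1) xor c               ≡⟨ xor-cancelˡ (S 1 (j 1)) (b 1) ⟩
    b 1                           ∎
    where
    corner : K 1 (j 1) ≡ true
    corner = border-top N (j 1) (proj₁ (admissible-first N j adm)) (proj₂ (admissible-first N j adm))
  values (suc (suc i)) _ le = begin
    A (2 + i) (j (2 + i))                  ≡⟨ inner-column N j adm A (suc i) (s≤s z≤n) le′ ⟩
    inner S (suc i) J xor (c ∧ inner K (suc i) J)
                                           ≡⟨ cong₂ (λ s k → s xor (c ∧ k)) (iS (suc i) J ix) (inner-border N (suc i) J ix) ⟩
    T (suc i) J xor (c ∧ false)            ≡⟨ cong (T (suc i) J xor_) (∧-zeroʳ c) ⟩
    T (suc i) J xor false                  ≡⟨ xor-identityʳ (T (suc i) J) ⟩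
    T (suc i) J                            ≡⟨ vT (suc i) (s≤s z≤n) le′ ⟩
    b (2 + i)                              ∎
    where
    le′ : suc i ≤ mR N
    le′ = mR-pred N (suc i) le
    J : ℕ
    J = innerColumns j (suc i)
    ix : InIdx N (suc i) J
    ix = admissible-index N (innerColumns j) (admissible-inner N j adm) (suc i) (s≤s z≤n) le′

realise : ∀ n j → Admissible n j → (b : ℕ → Bool) →
          Σ Array (λ a → IsRST n a × Realises n j b a)
realise 0 j _ b = O , O-RST 0 , λ { (suc i) _ () }
realise 1 j _ b =
  (λ _ _ → b 1) ,
  ((λ { _ _ (s≤s (s≤s z≤n)) (s≤s (s≤s _)) (s≤s ()) }) , λ _ _ _ → refl) ,
  λ { (suc zero) _ _ → refl ; (suc (suc i)) _ (s≤s ()) }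
realise 2 j _ b = O , O-RST 2 , λ { (suc i) _ () }
realise (suc (suc (suc N))) j adm b =
  realise-outer N j adm b (realise N (innerColumns j) (admissible-inner N j adm) (b ∘ suc))

-- RST(2) = 0: the rotation identifies the three entries, and the rule then
-- gives a 2 2 = a 1 1 + a 1 1 = 0.
size-two-zero : ∀ a → IsRST 2 a → SameTri 2 a O
size-two-zero a (sa , ra) = ST-zero-top-row 2 a sa top
  where
  a12≡a11 : a 1 2 ≡ a 1 1
  a12≡a11 = ra 1 1 (s≤s z≤n , s≤s z≤n , s≤s z≤n)
  a22≡a12 : a 2 2 ≡ a 1 2
  a22≡a12 = ra 1 2 (s≤s z≤n , s≤s z≤n , ≤-refl)
  a22 : a 2 2 ≡ false
  a22 = trans (sa 2 2 ≤-refl ≤-refl ≤-refl) (trans (cong (a 1 1 xor_) a12≡a11) (xor-same (a 1 1)))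
  top : ∀ k → 1 ≤ k → k ≤ 2 → a 1 k ≡ false
  top (suc zero) _ _ = trans (sym a12≡a11) (trans (sym a22≡a12) a22)
  top (suc (suc zero)) _ _ = trans (sym a22≡a12) a22
  top (suc (suc (suc k))) _ (s≤s (s≤s ()))

kernel-trivial : ∀ n j → Admissible n j → ∀ a → IsRST n a →
                 Realises n j (λ _ → false) a → SameTri n a O
kernel-trivial 0 j _ a _ _ (suc i) .0 (_ , () , z≤n)
kernel-trivial 1 j (_ , last) a (sa , _) va = ST-zero-top-row 1 a sa top
  where
  top : ∀ k → 1 ≤ k → k ≤ 1 → a 1 k ≡ false
  top (suc zero) _ _ = subst (λ t → a 1 t ≡ false) (last refl) (va 1 (s≤s z≤n) (s≤s z≤n))
  top (suc (suc k)) _ (s≤s ())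
kernel-trivial 2 j _ a ra _ = size-two-zero a ra
kernel-trivial (suc (suc (suc N))) j adm a ra va =
  outer-layer-zero N a ra inner-zero (j 1) 2≤j j≤ (va 1 (s≤s z≤n) (mR-suc N 0 z≤n))
  where
  2≤j : 2 ≤ j 1
  2≤j = proj₁ (admissible-first N j adm)
  j≤ : j 1 ≤ 2 + N
  j≤ = proj₂ (admissible-first N j adm)
  inner-zero : SameTri N (inner a) O
  inner-zero = kernel-trivial N (innerColumns j) (admissible-inner N j adm) (inner a) (inner-RST N a ra)
    (λ i 1≤i le → trans (sym (inner-column N j adm a i 1≤i le)) (va (suc i) (s≤s z≤n) (mR-suc N i le)))

-- By linearity, trivial kernel gives injectivity.
injective : ∀ n j → Admissible n j → (a a' : Array) → IsRST n a → IsRST n a' →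
            (∀ i → 1 ≤ i → i ≤ mR n → a i (j i) ≡ a' i (j i)) → SameTri n a a'
injective n j adm a a' ra ra' agree =
  difference-zero n a a' (kernel-trivial n j adm (a ⊕ a') (⊕-RST n a a' ra ra')
    (λ i 1≤i le → trans (cong (_xor a' i (j i)) (agree i 1≤i le)) (xor-same (a' i (j i)))))

mainTheorem6 : (n : ℕ) (j : ℕ → ℕ) →
    (∀ i → 1 ≤ i → i ≤ n / 3 → (2 * i ≤ j i) × (j i ≤ n ∸ i)) →
    (n % 3 ≡ 1 → j ((n + 2) / 3) ≡ (2 * n + 1) / 3) →
    GeneratingRST n (mR n) j
mainTheorem6 n j bounds last = realise n j (bounds , last) , injective n j (bounds , last)
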